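{- Let $p$ be a prime number and let $f\in\mathbb{Z}[X]$ be a polynomial of degree $1$ or $2$. Then the set $R_f:=\{f(a)/f(b): a,b\in\mathbb{Z}^+,\ f(b)\neq 0\}$ is dense in $\mathbb{Q}_p$ if and only if $f$ has a simple zero in $\mathbb{Z}_p$.
   Context: $\mathbb{Z}^+$ denotes the set of positive integers. -}

module Defs where

open import Data.Nat using (ℕ; suc; _^_)
open import Data.Nat.Primality using (Prime)
open import Data.Integer using (ℤ; +_; _+_; _-_; _*_; ∣_∣)
import Data.Nat.Divisibility as ℕD
open import Data.Integer.Divisibility using (_∣_)
open import Data.Rational using (ℚ; ↥_; ↧_)
open import Data.Product using (Σ; ∃; ∃-syntax; _×_)
open import Data.Sum using (_⊎_)
open import Relation.Nullary using (¬_)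
open import Relation.Binary.PropositionalEquality using (_≡_; _≢_)

record Poly≤2 : Set where
  constructor poly
  field
    c₀ c₁ c₂ : ℤ
open Poly≤2 public

Deg1or2 : Poly≤2 → Set
Deg1or2 f = (c₂ f ≢ + 0) ⊎ (c₂ f ≡ + 0 × c₁ f ≢ + 0)

eval : Poly≤2 → ℤ → ℤ
eval f x = c₀ f + c₁ f * x + c₂ f * (x * x)

deriv : Poly≤2 → Poly≤2
deriv f = poly (c₁ f) (c₂ f + c₂ f) (+ 0)

-- p-adic integers as the inverse limit lim ℤ/p^n ℤ: a sequence α with α(n+1) ≡ α(n) (mod p^n).
record Zp (p : ℕ) : Set where
  field
    approx : ℕ → ℤ
    compat : ∀ n → (+ (p ^ n)) ∣ (approx (suc n) - approx n)
open Zp public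

IsRoot : (p : ℕ) → Poly≤2 → Zp p → Set
IsRoot p g α = ∀ n → (+ (p ^ n)) ∣ eval g (approx α n)

HasSimpleZero : (p : ℕ) → Poly≤2 → Set
HasSimpleZero p f = Σ (Zp p) λ α → IsRoot p f α × ¬ IsRoot p (deriv f) α

-- v_p(N / D) ≥ k  (D ≠ 0): N/D = p^k u / w with p ∤ w
ValGe : (p : ℕ) (k : ℕ) (N D : ℤ) → Set
ValGe p k N D = ∃[ u ] ∃[ w ] (¬ (p ℕD.∣ ∣ w ∣) × w * N ≡ (+ (p ^ k)) * u * D)

-- R_f = { f(a)/f(b) : a,b ∈ ℤ⁺, f(b) ≠ 0 } is dense in ℚ_p.
-- Since ℚ is dense in ℚ_p, this says: for every x ∈ ℚ and k ∈ ℕ there are a,b ≥ 1 with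
-- f(b) ≠ 0 and |f(a)/f(b) - x|_p ≤ p^(-k), i.e. v_p((D f(a) - N f(b)) / (D f(b))) ≥ k for x = N/D.
DenseInQp : (p : ℕ) → Poly≤2 → Set
DenseInQp p f = ∀ (x : ℚ) (k : ℕ) → ∃[ a ] ∃[ b ]
  (eval f (+ suc b) ≢ + 0 ×
   ValGe p k ((↧ x) * eval f (+ suc a) - (↥ x) * eval f (+ suc b)) ((↧ x) * eval f (+ suc b)))

{-# OPTIONS --safe #-}
-- Everything rests on the identity f'(x)² = 4c₂f(x) + disc f. Let disc f ≠ 0 have valuation δ.
-- If v(f(x)) > δ then v(f'(x)) = δ/2 < v(f(x))/2, so Newton's iteration from x converges to a
-- simple zero of f in ℤ_p (Hensel). Near such an x, f(x + p^m y) ≈ f(x) + f'(x) p^m y is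
-- essentially linear in y, so f(x + p^m N)/f(x + p^m D) is p-adically close to N/D. Hence both
-- density and having a simple zero are equivalent to f taking values of arbitrarily large
-- valuation at positive integers. If disc f = 0 then c₂ ≠ 0 by the degree assumption, and
-- 4c₂f = f'² makes every f(a)/f(b) a square, of even valuation, so R_f stays away from p;
-- f has no simple zero either, since f' vanishes wherever f does.
module Submission where

open import Data.Empty using (⊥; ⊥-elim)
open import Data.Nat as ℕ using (ℕ; zero; suc; _≤_; _<_; s≤s)
import Data.Nat.Properties as ℕP
import Data.Nat.Divisibility as ℕD
import Data.Nat.Tactic.RingSolver as ℕSolver
import Data.Nat.Coprimality as Coprimality
open import Data.Nat.Coprimality using (Coprime; coprime-Bézout; 1-coprimeTo)
open import Data.Nat.GCD using (module Bézout)
open import Data.Nat.Primality using (Prime; euclidsLemma; prime⇒nonZero; prime⇒nonTrivial; prime⇒irreducible)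
open import Data.Integer as ℤ using (ℤ; +_; -[1+_]; _+_; _-_; _*_; -_; ∣_∣)
import Data.Integer.Properties as ℤP
open import Data.Integer.DivMod using (a≡a%n+[a/n]*n)
open import Data.Integer.Divisibility.Signed
open import Data.Integer.Tactic.RingSolver using (solve-∀)
open import Data.Product using (Σ; ∃-syntax; _×_; _,_; proj₁; proj₂)
open import Data.Rational using (mkℚ; 0ℚ)
open import Data.Sum using (inj₁; inj₂; [_,_]′)
open import Function.Base using (_∘_)
open import Function.Bundles using (_⇔_; mk⇔)
open import Relation.Nullary using (¬_; Dec; yes; no)
open import Relation.Binary.PropositionalEquality

open import Defs

disc : Poly≤2 → ℤ
disc f = c₁ f * c₁ f - (c₂ f + c₂ f) * (c₀ f + c₀ f)

eval-+ : ∀ f x t → eval f (x + t) ≡ eval f x + eval (deriv f) x * t + c₂ f * (t * t)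
eval-+ (poly a b c) x t = identity a b c x t
  where
  identity : ∀ a b c x t → a + b * (x + t) + c * ((x + t) * (x + t)) ≡
             a + b * x + c * (x * x) + (b + (c + c) * x + + 0 * (x * x)) * t + c * (t * t)
  identity = solve-∀

deriv²≡4c₂f+disc : ∀ f x →
  eval (deriv f) x * eval (deriv f) x ≡ (c₂ f + c₂ f) * (eval f x + eval f x) + disc f
deriv²≡4c₂f+disc (poly a b c) x = identity a b c x
  where
  identity : ∀ a b c x →
    (b + (c + c) * x + + 0 * (x * x)) * (b + (c + c) * x + + 0 * (x * x)) ≡
    (c + c) * (a + b * x + c * (x * x) + (a + b * x + c * (x * x))) + (b * b - (c + c) * (a + a))
  identity = solve-∀

eval-cong : ∀ f {k x y} → k ∣ x - y → k ∣ eval f x - eval f y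
eval-cong (poly a b c) {k} {x} {y} k∣x-y =
  subst (k ∣_) (sym (factorisation a b c x y)) (∣m⇒∣m*n (b + c * (x + y)) k∣x-y)
  where
  factorisation : ∀ a b c x y →
    a + b * x + c * (x * x) - (a + b * y + c * (y * y)) ≡ (x - y) * (b + c * (x + y))
  factorisation = solve-∀

eval-cross-difference : ∀ f r s y z →
  z * eval f (r + s * y) - y * eval f (r + s * z) ≡
  (z - y) * eval f r + c₂ f * (s * s) * (y * z) * (y - z)
eval-cross-difference (poly a b c) r s y z = identity a b c r s y z
  where
  identity : ∀ a b c r s y z →
    z * (a + b * (r + s * y) + c * ((r + s * y) * (r + s * y))) -
    y * (a + b * (r + s * z) + c * ((r + s * z) * (r + s * z))) ≡
    (z - y) * (a + b * r + c * (r * r)) + c * (s * s) * (y * z) * (y - z)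
  identity = solve-∀

cast-1+*≡* : ∀ a b c d → 1 ℕ.+ a ℕ.* b ≡ c ℕ.* d → + 1 + + a * + b ≡ + c * + d
cast-1+*≡* a b c d eq = trans (cong (_+_ (+ 1)) (sym (ℤP.pos-* a b))) (trans (cong +_ eq) (ℤP.pos-* c d))

∣m-n∣n⇒∣m : ∀ {i m n} → i ∣ m - n → i ∣ n → i ∣ m
∣m-n∣n⇒∣m i∣m-n i∣n = ∣m+n∣n⇒∣m i∣m-n (∣m⇒∣-m i∣n)

∣m-n∣m⇒∣n : ∀ {i m n} → i ∣ m - n → i ∣ m → i ∣ n
∣m-n∣m⇒∣n {i} {m} {n} i∣m-n i∣m =
  subst (i ∣_) (ℤP.neg-involutive n) (∣m⇒∣-m (∣m+n∣m⇒∣n i∣m-n i∣m))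

*-≢0 : ∀ {x y} → x ≢ + 0 → y ≢ + 0 → x * y ≢ + 0
*-≢0 {x} x≢0 y≢0 = [ x≢0 , y≢0 ]′ ∘ ℤP.i*j≡0⇒i≡0∨j≡0 x

double-≢0 : ∀ {x} → x ≢ + 0 → x + x ≢ + 0
double-≢0 {x} x≢0 x+x≡0 = *-≢0 {+ 2} (λ ()) x≢0 (trans (double x) x+x≡0)
  where
  double : ∀ x → + 2 * x ≡ x + x
  double = solve-∀

positive-representative : ∀ z m .{{_ : ℤ.NonZero m}} → ∃[ ρ ] m ∣ + suc ρ - z
positive-representative z m = ρ , divides (- (z-1 ℤ./ m)) representative
  where
  open ≡-Reasoning
  z-1 = z - + 1
  ρ = z-1 ℤ.% m
  representative : + suc ρ - z ≡ - (z-1 ℤ./ m) * m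
  representative = begin
    + 1 + + ρ - z              ≡⟨ shift (+ ρ) z ⟩
    + ρ - z-1                  ≡⟨ cong (λ y → + ρ - y) (a≡a%n+[a/n]*n z-1 m) ⟩
    + ρ - (+ ρ + z-1 ℤ./ m * m) ≡⟨ cancel (+ ρ) (z-1 ℤ./ m) m ⟩
    - (z-1 ℤ./ m) * m          ∎
    where
    shift : ∀ r z → + 1 + r - z ≡ r - (z - + 1)
    shift = solve-∀
    cancel : ∀ r q m → r - (r + q * m) ≡ - q * m
    cancel = solve-∀

module PAdic {p : ℕ} (p-prime : Prime p) where

  instance
    p-nonZero : ℕ.NonZero p
    p-nonZero = prime⇒nonZero p-prime

  infix 8 p^_
  p^_ : ℕ → ℤ
  p^ n = + (p ℕ.^ n)

  p^-nonZero : ∀ n → ℤ.NonZero (p^ n)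
  p^-nonZero n = ℕP.m^n≢0 p n

  p^-+ : ∀ m n → p^ (m ℕ.+ n) ≡ p^ m * p^ n
  p^-+ m n = trans (cong +_ (ℕP.^-distribˡ-+-* p m n)) (ℤP.pos-* (p ℕ.^ m) (p ℕ.^ n))

  p^1≡p : p^ 1 ≡ + p
  p^1≡p = cong +_ (ℕP.*-identityʳ p)

  p^-suc : ∀ n → p^ suc n ≡ + p * p^ n
  p^-suc n = ℤP.pos-* p (p ℕ.^ n)

  p^-mono-∣ : ∀ {m n} → m ≤ n → p^ m ∣ p^ n
  p^-mono-∣ {m} m≤n with ℕP.m≤n⇒∃[o]m+o≡n m≤n
  ... | o , refl = divides (p^ o) (trans (p^-+ m o) (ℤP.*-comm (p^ m) (p^ o)))

  p^∣p^*-shift : ∀ j x s → p^ j ∣ x + p^ j * s - x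
  p^∣p^*-shift j x s = divides s (shift x (p^ j) s)
    where
    shift : ∀ x q s → x + q * s - x ≡ s * q
    shift = solve-∀

  infix 4 p∤_
  p∤_ : ℤ → Set
  p∤ z = ¬ (+ p ∣ z)

  p∤-* : ∀ {x y} → p∤ x → p∤ y → p∤ (x * y)
  p∤-* {x} {y} p∤x p∤y p∣xy
    with euclidsLemma ∣ x ∣ ∣ y ∣ p-prime (subst (p ℕD.∣_) (ℤP.abs-* x y) (∣⇒∣ᵤ p∣xy))
  ... | inj₁ p∣x = p∤x (∣ᵤ⇒∣ p∣x)
  ... | inj₂ p∣y = p∤y (∣ᵤ⇒∣ p∣y)

  p∤-+ : ∀ {u} t → p∤ u → p∤ (u + + p * t)
  p∤-+ t p∤u p∣u+pt = p∤u (∣m+n∣n⇒∣m p∣u+pt (∣m⇒∣m*n t ∣-refl))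

  p∤⇒coprime : ∀ {n} → ¬ (p ℕD.∣ n) → Coprime p n
  p∤⇒coprime p∤n (d∣p , d∣n) with prime⇒irreducible p-prime d∣p
  ... | inj₁ d≡1 = d≡1
  ... | inj₂ refl = ⊥-elim (p∤n d∣n)

  p∤⇒invertibleℕ : ∀ {n} → ¬ (p ℕD.∣ n) → ∃[ v ] + p ∣ + n * v - + 1
  p∤⇒invertibleℕ {n} p∤n with coprime-Bézout (p∤⇒coprime p∤n)
  ... | Bézout.+- x y eq = - + y , divides (- + x) (begin
    + n * - + y - + 1   ≡⟨ negate (+ n) (+ y) ⟩
    - (+ 1 + + y * + n) ≡⟨ cong -_ (cast-1+*≡* y n x p eq) ⟩
    - (+ x * + p)       ≡⟨ ℤP.neg-distribˡ-* (+ x) (+ p) ⟩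
    - + x * + p         ∎)
    where
    open ≡-Reasoning
    negate : ∀ n y → n * - y - + 1 ≡ - (+ 1 + y * n)
    negate = solve-∀
  ... | Bézout.-+ x y eq = + y , divides (+ x) (begin
    + n * + y - + 1       ≡⟨ commute (+ n) (+ y) ⟩
    + y * + n - + 1       ≡⟨ cong (_- + 1) (sym (cast-1+*≡* x p y n eq)) ⟩
    + 1 + + x * + p - + 1 ≡⟨ cancel (+ x * + p) ⟩
    + x * + p             ∎)
    where
    open ≡-Reasoning
    commute : ∀ n y → n * y - + 1 ≡ y * n - + 1
    commute = solve-∀
    cancel : ∀ a → + 1 + a - + 1 ≡ a
    cancel = solve-∀

  p∤⇒invertible : ∀ {u} → p∤ u → ∃[ v ] + p ∣ u * v - + 1
  p∤⇒invertible {+ n} p∤n = p∤⇒invertibleℕ (p∤n ∘ ∣ᵤ⇒∣)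
  p∤⇒invertible { -[1+ n ]} p∤u with p∤⇒invertibleℕ {suc n} (p∤u ∘ ∣m⇒∣-m ∘ ∣ᵤ⇒∣)
  ... | v , p∣nv-1 = - v , subst (+ p ∣_) (negate (+ suc n) v) p∣nv-1
    where
    negate : ∀ n v → n * v - + 1 ≡ - n * - v - + 1
    negate = solve-∀

  infix 4 p^_∥_
  record p^_∥_ (v : ℕ) (z : ℤ) : Set where
    constructor exactly
    field
      unit : ℤ
      z≡p^v*unit : z ≡ p^ v * unit
      p∤unit : p∤ unit

  ∥⇒∣ : ∀ {v z} → p^ v ∥ z → p^ v ∣ z
  ∥⇒∣ {v} (exactly u refl _) = divides u (ℤP.*-comm (p^ v) u)

  ∥⇒¬∣-suc : ∀ {v z} → p^ v ∥ z → ¬ (p^ suc v ∣ z)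
  ∥⇒¬∣-suc {v} (exactly u refl p∤u) (divides q eq) =
    p∤u (divides q (ℤP.*-cancelˡ-≡ (p^ v) u (q * + p) {{p^-nonZero v}} p^v*u≡))
    where
    regroup : ∀ q p a → q * (p * a) ≡ a * (q * p)
    regroup = solve-∀
    p^v*u≡ : p^ v * u ≡ p^ v * (q * + p)
    p^v*u≡ = trans eq (trans (cong (q *_) (p^-suc v)) (regroup q (+ p) (p^ v)))

  ∥⇒≢0 : ∀ {v z} → p^ v ∥ z → z ≢ + 0
  ∥⇒≢0 {v} z∥ refl = ∥⇒¬∣-suc {v} z∥ (divides (+ 0) refl)

  unit-∥ : ∀ {u} → p∤ u → p^ 0 ∥ u
  unit-∥ {u} p∤u = exactly u (sym (ℤP.*-identityˡ u)) p∤u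

  ∥-* : ∀ {i j x y} → p^ i ∥ x → p^ j ∥ y → p^ (i ℕ.+ j) ∥ x * y
  ∥-* {i} {j} (exactly u refl p∤u) (exactly u' refl p∤u') =
    exactly (u * u') (trans (interchange (p^ i) u (p^ j) u') (cong (_* (u * u')) (sym (p^-+ i j)))) (p∤-* p∤u p∤u')
    where
    interchange : ∀ a u b u' → a * u * (b * u') ≡ a * b * (u * u')
    interchange = solve-∀

  ∥-p^* : ∀ m {j z} → p^ j ∥ z → p^ (m ℕ.+ j) ∥ p^ m * z
  ∥-p^* m {j} (exactly u refl p∤u) =
    exactly u (trans (sym (ℤP.*-assoc (p^ m) (p^ j) u)) (cong (_* u) (sym (p^-+ m j)))) p∤u

  ∥-cong-mod : ∀ {v y z} → p^ v ∥ y → p^ suc v ∣ z - y → p^ v ∥ z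
  ∥-cong-mod {v} {_} {z} (exactly u refl p∤u) (divides q eq) = exactly (u + + p * q) z≡ (p∤-+ q p∤u)
    where
    open ≡-Reasoning
    z≡ : z ≡ p^ v * (u + + p * q)
    z≡ = begin
      z                                ≡⟨ split z (p^ v * u) ⟩
      z - p^ v * u + p^ v * u          ≡⟨ cong (_+ p^ v * u) (trans eq (cong (q *_) (p^-suc v))) ⟩
      q * (+ p * p^ v) + p^ v * u      ≡⟨ collect q (+ p) (p^ v) u ⟩
      p^ v * (u + + p * q)             ∎
      where
      split : ∀ z y → z ≡ z - y + y
      split = solve-∀
      collect : ∀ q p a u → q * (p * a) + a * u ≡ a * (u + p * q)
      collect = solve-∀

  valuation : ∀ {z} → z ≢ + 0 → ∃[ v ] p^ v ∥ z
  valuation {z} = bounded (suc ∣ z ∣) z (ℕP.n<1+n ∣ z ∣)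
    where
    bounded : ∀ bound z → ∣ z ∣ < bound → z ≢ + 0 → ∃[ v ] p^ v ∥ z
    bounded (suc bound) z ∣z∣<bound z≢0 with + p ∣? z
    ... | no p∤z = 0 , unit-∥ p∤z
    ... | yes (divides q refl) with bounded bound q ∣q∣<bound q≢0
      where
      q≢0 : q ≢ + 0
      q≢0 refl = z≢0 refl
      ∣q∣<bound : ∣ q ∣ < bound
      ∣q∣<bound = ℕP.<-≤-trans
        (ℕP.m<m*n ∣ q ∣ p {{ℤ.≢-nonZero q≢0}} (ℕ.nonTrivial⇒n>1 p {{prime⇒nonTrivial p-prime}}))
        (ℕP.≤-pred (subst (_< suc bound) (ℤP.abs-* q (+ p)) ∣z∣<bound))
    ... | v , exactly u refl p∤u = suc v , exactly u regroup p∤u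
      where
      regroup : p^ v * u * + p ≡ p^ suc v * u
      regroup = trans (ℤP.*-comm (p^ v * u) (+ p))
        (trans (sym (ℤP.*-assoc (+ p) (p^ v) u)) (cong (_* u) (sym (p^-suc v))))

  ∣∧∥⇒≤ : ∀ {k v z} → p^ k ∣ z → p^ v ∥ z → k ≤ v
  ∣∧∥⇒≤ {k} {v} k∣z z∥ with k ℕ.≤? v
  ... | yes k≤v = k≤v
  ... | no k≰v = ⊥-elim (∥⇒¬∣-suc z∥ (∣-trans (p^-mono-∣ (ℕP.≰⇒> k≰v)) k∣z))

  ∥-unique : ∀ {i j z} → p^ i ∥ z → p^ j ∥ z → i ≡ j
  ∥-unique i∥ j∥ = ℕP.≤-antisym (∣∧∥⇒≤ (∥⇒∣ i∥) j∥) (∣∧∥⇒≤ (∥⇒∣ j∥) i∥)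

  p^∣-cancel-unit : ∀ {k w z} → p∤ w → p^ k ∣ w * z → p^ k ∣ z
  p^∣-cancel-unit {k} {z = z} p∤w k∣wz with z ℤ.≟ + 0
  ... | yes refl = divides (+ 0) refl
  ... | no z≢0 with valuation z≢0
  ... | v , z∥ = ∣-trans (p^-mono-∣ (∣∧∥⇒≤ {k} k∣wz (∥-* (unit-∥ p∤w) z∥))) (∥⇒∣ z∥)

  p^∣square⇒p^∣ : ∀ {n z} → p^ (n ℕ.+ n) ∣ z * z → p^ n ∣ z
  p^∣square⇒p^∣ {n} {z} n+n∣z² with z ℤ.≟ + 0
  ... | yes refl = divides (+ 0) refl
  ... | no z≢0 with valuation z≢0
  ... | v , z∥ with n ℕ.≤? v
  ...   | yes n≤v = ∣-trans (p^-mono-∣ n≤v) (∥⇒∣ z∥)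
  ...   | no n≰v =
    ⊥-elim (ℕP.<⇒≱ (ℕP.+-mono-< v<n v<n) (∣∧∥⇒≤ {n ℕ.+ n} n+n∣z² (∥-* z∥ z∥)))
    where v<n = ℕP.≰⇒> n≰v

  unit*square≢p*unit*square : ∀ {w w' x y} → p∤ w → p∤ w' → y ≢ + 0 →
                              w * (x * x) ≢ + p * w' * (y * y)
  unit*square≢p*unit*square {w} {w'} {x} {y} p∤w p∤w' y≢0 eq with valuation y≢0
  ... | j , y∥ = compare-valuations (x ℤ.≟ + 0)
    where
    rhs∥ : p^ suc (j ℕ.+ j) ∥ + p * w' * (y * y)
    rhs∥ = ∥-* (subst (λ a → p^ 1 ∥ a * w') p^1≡p (∥-p^* 1 (unit-∥ p∤w'))) (∥-* y∥ y∥)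
    compare-valuations : Dec (x ≡ + 0) → ⊥
    compare-valuations (yes refl) = ∥⇒≢0 rhs∥ (trans (sym eq) (ℤP.*-zeroʳ w))
    compare-valuations (no x≢0) with valuation x≢0
    ... | i , x∥ = ℕP.even≢odd i j (trans (sym (n+n≡2*n i)) (trans i+i≡1+j+j (cong suc (n+n≡2*n j))))
      where
      n+n≡2*n : ∀ n → n ℕ.+ n ≡ 2 ℕ.* n
      n+n≡2*n n = cong (n ℕ.+_) (sym (ℕP.+-identityʳ n))
      i+i≡1+j+j : i ℕ.+ i ≡ suc (j ℕ.+ j)
      i+i≡1+j+j = ∥-unique (∥-* (unit-∥ p∤w) (∥-* x∥ x∥)) (subst (p^ suc (j ℕ.+ j) ∥_) (sym eq) rhs∥)

  ValGe-intro : ∀ {k j N D} → p^ (k ℕ.+ j) ∣ N → p^ j ∥ D → ValGe p k N D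
  ValGe-intro {k} {j} (divides q refl) (exactly W refl p∤W) = q , W , p∤W ∘ ∣ᵤ⇒∣ , regroup
    where
    regroup : W * (q * p^ (k ℕ.+ j)) ≡ p^ k * q * (p^ j * W)
    regroup = trans (cong (λ a → W * (q * a)) (p^-+ k j)) (rearrange W q (p^ k) (p^ j))
      where
      rearrange : ∀ w q a b → w * (q * (a * b)) ≡ a * q * (b * w)
      rearrange = solve-∀

  approx-cong : (α : Zp p) → ∀ n i → p^ n ∣ approx α (i ℕ.+ n) - approx α n
  approx-cong α n zero = divides (+ 0) (ℤP.+-inverseʳ (approx α n))
  approx-cong α n (suc i) =
    subst (p^ n ∣_) (telescope (approx α (suc i ℕ.+ n)) (approx α (i ℕ.+ n)) (approx α n))
      (∣m∣n⇒∣m+n (∣-trans (p^-mono-∣ (ℕP.m≤n+m n i)) step) (approx-cong α n i))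
    where
    step : p^ (i ℕ.+ n) ∣ approx α (suc i ℕ.+ n) - approx α (i ℕ.+ n)
    step = ∣ᵤ⇒∣ (compat α (i ℕ.+ n))
    telescope : ∀ a b c → a - b + (b - c) ≡ a - c
    telescope = solve-∀

module Quadratic {p : ℕ} (p-prime : Prime p) (f : Poly≤2) where

  open PAdic p-prime

  HasApproximateZeros : Set
  HasApproximateZeros = ∀ M → ∃[ ρ ] p^ M ∣ eval f (+ suc ρ)

  root⇒approximate-zeros : ∀ α → IsRoot p f α → HasApproximateZeros
  root⇒approximate-zeros α root M with positive-representative (approx α M) (p^ M) {{p^-nonZero M}}
  ... | ρ , M∣ρ-α = ρ , ∣m-n∣n⇒∣m (eval-cong f M∣ρ-α) (∣ᵤ⇒∣ (root M))

  dense⇒approximate-zeros : DenseInQp p f → HasApproximateZeros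
  dense⇒approximate-zeros dense M with dense 0ℚ M
  ... | a , b , _ , u , w , p∤w , eq = a , p^∣-cancel-unit {M} {w} (p∤w ∘ ∣⇒∣ᵤ) (divides (u * fb) w*fa≡)
    where
    fa = eval f (+ suc a)
    fb = eval f (+ suc b)
    w*fa≡ : w * fa ≡ u * fb * p^ M
    w*fa≡ = trans (expand w fa fb) (trans eq (rearrange (p^ M) u fb))
      where
      expand : ∀ w fa fb → w * fa ≡ w * (+ 1 * fa - + 0 * fb)
      expand = solve-∀
      rearrange : ∀ q u fb → q * u * (+ 1 * fb) ≡ u * fb * q
      rearrange = solve-∀

  disc≡0⇒deriv²≡4c₂f : disc f ≡ + 0 → ∀ x →
    eval (deriv f) x * eval (deriv f) x ≡ (c₂ f + c₂ f) * (eval f x + eval f x)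
  disc≡0⇒deriv²≡4c₂f Δ≡0 x =
    trans (deriv²≡4c₂f+disc f x) (trans (cong (_+_ 4c₂f) Δ≡0) (ℤP.+-identityʳ 4c₂f))
    where 4c₂f = (c₂ f + c₂ f) * (eval f x + eval f x)

  disc≡0⇒deriv²-relation : disc f ≡ + 0 → ∀ w X x y → w * eval f x ≡ X * eval f y →
    w * (eval (deriv f) x * eval (deriv f) x) ≡ X * (eval (deriv f) y * eval (deriv f) y)
  disc≡0⇒deriv²-relation Δ≡0 w X x y relation = begin
    w * (eval (deriv f) x * eval (deriv f) x)  ≡⟨ cong (w *_) (disc≡0⇒deriv²≡4c₂f Δ≡0 x) ⟩
    w * ((c + c) * (eval f x + eval f x))      ≡⟨ distribute w c (eval f x) ⟩
    (c + c) * (w * eval f x + w * eval f x)    ≡⟨ cong (λ z → (c + c) * (z + z)) relation ⟩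
    (c + c) * (X * eval f y + X * eval f y)    ≡⟨ sym (distribute X c (eval f y)) ⟩
    X * ((c + c) * (eval f y + eval f y))      ≡⟨ cong (X *_) (sym (disc≡0⇒deriv²≡4c₂f Δ≡0 y)) ⟩
    X * (eval (deriv f) y * eval (deriv f) y)  ∎
    where
    open ≡-Reasoning
    c = c₂ f
    distribute : ∀ w c z → w * ((c + c) * (z + z)) ≡ (c + c) * (w * z + w * z)
    distribute = solve-∀

  disc≡0⇒deriv-root : disc f ≡ + 0 → ∀ α → IsRoot p f α → IsRoot p (deriv f) α
  disc≡0⇒deriv-root Δ≡0 α root n =
    ∣⇒∣ᵤ (∣m-n∣m⇒∣n {m = eval (deriv f) x} (eval-cong (deriv f) {x = x} (approx-cong α n n))
                                          (p^∣square⇒p^∣ {n} n+n∣f'²))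
    where
    x = approx α (n ℕ.+ n)
    n+n∣f : p^ (n ℕ.+ n) ∣ eval f x
    n+n∣f = ∣ᵤ⇒∣ (root (n ℕ.+ n))
    n+n∣f'² : p^ (n ℕ.+ n) ∣ eval (deriv f) x * eval (deriv f) x
    n+n∣f'² = subst (p^ (n ℕ.+ n) ∣_) (sym (disc≡0⇒deriv²≡4c₂f Δ≡0 x))
      (∣n⇒∣m*n (c₂ f + c₂ f) (∣m∣n⇒∣m+n n+n∣f n+n∣f))

  simple-zero⇒disc≢0 : HasSimpleZero p f → disc f ≢ + 0
  simple-zero⇒disc≢0 (α , root , simple) Δ≡0 = simple (disc≡0⇒deriv-root Δ≡0 α root)

  deriv²-∥ : ∀ {δ x} → p^ δ ∥ disc f → p^ suc δ ∣ eval f x →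
             p^ δ ∥ eval (deriv f) x * eval (deriv f) x
  deriv²-∥ {δ} {x} Δ∥ fx∣ = ∥-cong-mod Δ∥ (subst (p^ suc δ ∣_) (sym difference) 4c₂f∣)
    where
    4c₂f = (c₂ f + c₂ f) * (eval f x + eval f x)
    4c₂f∣ : p^ suc δ ∣ 4c₂f
    4c₂f∣ = ∣n⇒∣m*n (c₂ f + c₂ f) (∣m∣n⇒∣m+n fx∣ fx∣)
    difference : eval (deriv f) x * eval (deriv f) x - disc f ≡ 4c₂f
    difference = trans (cong (_- disc f) (deriv²≡4c₂f+disc f x)) (cancel 4c₂f (disc f))
      where
      cancel : ∀ a b → a + b - b ≡ a
      cancel = solve-∀

  deriv-valuation : ∀ {δ x} → p^ δ ∥ disc f → p^ suc δ ∣ eval f x →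
                    ∃[ e ] (e ℕ.+ e ≡ δ × p^ e ∥ eval (deriv f) x)
  deriv-valuation {δ} {x} Δ∥ fx∣ with valuation f'x≢0
    where
    f'x≢0 : eval (deriv f) x ≢ + 0
    f'x≢0 f'x≡0 = ∥⇒≢0 (deriv²-∥ Δ∥ fx∣) (cong (λ y → y * y) f'x≡0)
  ... | e , f'x∥ = e , ∥-unique (∥-* f'x∥ f'x∥) (deriv²-∥ Δ∥ fx∣) , f'x∥

  p^∣square-term : ∀ c {e j t} → e < j → p^ j ∣ t → p^ suc (e ℕ.+ j) ∣ c * (t * t)
  p^∣square-term c {e} {j} e<j (divides s refl) =
    ∣n⇒∣m*n c (∣-trans (p^-mono-∣ (ℕP.+-monoˡ-≤ j e<j)) (divides (s * s) square))
    where
    square : s * p^ j * (s * p^ j) ≡ s * s * p^ (j ℕ.+ j)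
    square = trans (regroup s (p^ j)) (cong (s * s *_) (sym (p^-+ j j)))
      where
      regroup : ∀ s a → s * a * (s * a) ≡ s * s * (a * a)
      regroup = solve-∀

  hensel-step : ∀ {e j x} → e < j → p^ e ∥ eval (deriv f) x → p^ (e ℕ.+ j) ∣ eval f x →
                ∃[ s ] p^ (e ℕ.+ suc j) ∣ eval f (x + p^ j * s)
  hensel-step {e} {j} {x} e<j (exactly U f'x≡ p∤U) (divides F fx≡) with p∤⇒invertible p∤U
  ... | v , divides q Uv-1≡ =
    -- s ≡ -F/U (mod p) kills the linear term; the quadratic one is divisible by p^(j+j).
    s , subst (λ i → p^ i ∣ eval f (x + t)) (sym (ℕP.+-suc e j)) f[x+t]∣
    where
    open ≡-Reasoning
    s = - (F * v)
    t = p^ j * s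
    linear-part : eval f x + eval (deriv f) x * t ≡ - F * q * p^ suc (e ℕ.+ j)
    linear-part = begin
      eval f x + eval (deriv f) x * t                   ≡⟨ cong₂ (λ a b → a + b * t) fx≡ f'x≡ ⟩
      F * p^ (e ℕ.+ j) + p^ e * U * t                   ≡⟨ cong (λ a → F * a + p^ e * U * t) (p^-+ e j) ⟩
      F * (p^ e * p^ j) + p^ e * U * (p^ j * - (F * v)) ≡⟨ factor F U v (p^ e) (p^ j) ⟩
      - F * (U * v - + 1) * (p^ e * p^ j)               ≡⟨ cong (λ y → - F * y * (p^ e * p^ j)) Uv-1≡ ⟩
      - F * (q * + p) * (p^ e * p^ j)                   ≡⟨ regroup F q (+ p) (p^ e * p^ j) ⟩
      - F * q * (+ p * (p^ e * p^ j))                   ≡⟨ cong (λ a → - F * q * (+ p * a)) (sym (p^-+ e j)) ⟩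
      - F * q * (+ p * p^ (e ℕ.+ j))                    ≡⟨ cong (- F * q *_) (sym (p^-suc (e ℕ.+ j))) ⟩
      - F * q * p^ suc (e ℕ.+ j)                        ∎
      where
      factor : ∀ F U v a b → F * (a * b) + a * U * (b * - (F * v)) ≡ - F * (U * v - + 1) * (a * b)
      factor = solve-∀
      regroup : ∀ F q p a → - F * (q * p) * a ≡ - F * q * (p * a)
      regroup = solve-∀
    f[x+t]∣ : p^ suc (e ℕ.+ j) ∣ eval f (x + t)
    f[x+t]∣ = subst (p^ suc (e ℕ.+ j) ∣_) (sym (eval-+ f x t))
      (∣m∣n⇒∣m+n (divides (- F * q) linear-part) (p^∣square-term (c₂ f) e<j (divides s (ℤP.*-comm (p^ j) s))))

  deriv-step : ∀ {e j x} s → e < j → p^ e ∥ eval (deriv f) x → p^ e ∥ eval (deriv f) (x + p^ j * s)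
  deriv-step {e} {j} {x} s e<j f'x∥ =
    ∥-cong-mod f'x∥ (∣-trans (p^-mono-∣ e<j) (eval-cong (deriv f) (p^∣p^*-shift j x s)))

  -- j is the valuation of the next Newton correction.
  record HenselApproximation (e j : ℕ) : Set where
    field
      point : ℤ
      deriv-∥ : p^ e ∥ eval (deriv f) point
      eval-∣ : p^ (e ℕ.+ j) ∣ eval f point
  open HenselApproximation

  refine : ∀ {e j} → e < j → (x : HenselApproximation e j) →
           Σ (HenselApproximation e (suc j)) λ y → p^ j ∣ point y - point x
  refine {e} {j} e<j x with hensel-step e<j (deriv-∥ x) (eval-∣ x)
  ... | s , f[x+t]∣ = y , p^∣p^*-shift j (point x) s
    where
    y : HenselApproximation e (suc j)
    point y = point x + p^ j * s
    deriv-∥ y = deriv-step s e<j (deriv-∥ x)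
    eval-∣ y = f[x+t]∣

  hensel : ∀ {e x} → p^ e ∥ eval (deriv f) x → p^ (e ℕ.+ suc e) ∣ eval f x → HasSimpleZero p f
  hensel {e} {x} f'x∥ fx∣ = α , root , simple
    where
    approximation : ∀ n → HenselApproximation e (n ℕ.+ suc e)
    approximation zero = record { point = x ; deriv-∥ = f'x∥ ; eval-∣ = fx∣ }
    approximation (suc n) = proj₁ (refine (ℕP.m≤n+m (suc e) n) (approximation n))
    α : Zp p
    approx α n = point (approximation n)
    compat α n = ∣⇒∣ᵤ (∣-trans (p^-mono-∣ (ℕP.m≤m+n n (suc e))) close)
      where close = proj₂ (refine (ℕP.m≤n+m (suc e) n) (approximation n))
    root : IsRoot p f α
    root n = ∣⇒∣ᵤ (∣-trans (p^-mono-∣ (ℕP.≤-trans (ℕP.m≤m+n n (suc e)) (ℕP.m≤n+m _ e)))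
                           (eval-∣ (approximation n)))
    simple : ¬ IsRoot p (deriv f) α
    simple f'α = ∥⇒¬∣-suc (deriv-∥ (approximation (suc e))) (∣ᵤ⇒∣ (f'α (suc e)))

  approximate-zeros⇒simple-zero : disc f ≢ + 0 → HasApproximateZeros → HasSimpleZero p f
  approximate-zeros⇒simple-zero Δ≢0 zeros =
    let (δ , Δ∥) = valuation Δ≢0
        (a , fa∣) = zeros (suc δ)
        (e , e+e≡δ , f'a∥) = deriv-valuation Δ∥ fa∣
    in hensel f'a∥ (subst (λ i → p^ i ∣ eval f (+ suc a)) (sym (trans (ℕP.+-suc e e) (cong suc e+e≡δ))) fa∣)

  eval-shift-∥ : ∀ {e j r t} → e < j → p^ e ∥ eval (deriv f) r → p^ j ∥ t →
                 p^ suc (e ℕ.+ j) ∣ eval f r → p^ (e ℕ.+ j) ∥ eval f (r + t)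
  eval-shift-∥ {e} {j} {r} {t} e<j f'r∥ t∥ fr∣ =
    ∥-cong-mod (∥-* f'r∥ t∥) (subst (p^ suc (e ℕ.+ j) ∣_) (sym remainder)
      (∣m∣n⇒∣m+n fr∣ (p^∣square-term (c₂ f) e<j (∥⇒∣ t∥))))
    where
    remainder : eval f (r + t) - eval (deriv f) r * t ≡ eval f r + c₂ f * (t * t)
    remainder = trans (cong (_- eval (deriv f) r * t) (eval-+ f r t)) (cancel (eval f r) _ _)
      where
      cancel : ∀ a b c → a + b + c - b ≡ a + c
      cancel = solve-∀

  cross-difference-∣ : ∀ {m dd D₀} r N' N D → D ≡ p^ dd * D₀ →
    p^ (m ℕ.+ m ℕ.+ dd) ∣ eval f r → p^ (m ℕ.+ m ℕ.+ dd) ∣ N - N' →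
    p^ (m ℕ.+ m ℕ.+ dd) ∣ D * eval f (r + p^ m * N') - N * eval f (r + p^ m * D)
  cross-difference-∣ {m} {dd} {D₀} r N' N D D≡ fr∣ N≡N' = subst (p^ M ∣_) (sym difference≡)
    (∣m∣n⇒∣m-n (∣m∣n⇒∣m+n (∣n⇒∣m*n (D - N') fr∣) cross-term∣) (∣m⇒∣m*n fb N≡N'))
    where
    open ≡-Reasoning
    M = m ℕ.+ m ℕ.+ dd
    fa = eval f (r + p^ m * N')
    fb = eval f (r + p^ m * D)
    cross-term = c₂ f * (p^ m * p^ m) * (N' * D) * (N' - D)

    difference≡ : D * fa - N * fb ≡ (D - N') * eval f r + cross-term - (N - N') * fb
    difference≡ = begin
      D * fa - N * fb                  ≡⟨ split D fa N N' fb ⟩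
      D * fa - N' * fb - (N - N') * fb ≡⟨ cong (_- (N - N') * fb) (eval-cross-difference f r (p^ m) N' D) ⟩
      (D - N') * eval f r + cross-term - (N - N') * fb ∎
      where
      split : ∀ D fa N N' fb → D * fa - N * fb ≡ D * fa - N' * fb - (N - N') * fb
      split = solve-∀

    cross-term∣ : p^ M ∣ cross-term
    cross-term∣ = divides (c₂ f * (N' * D₀) * (N' - D)) (begin
      cross-term
        ≡⟨ cong (λ z → c₂ f * (p^ m * p^ m) * (N' * z) * (N' - D)) D≡ ⟩
      c₂ f * (p^ m * p^ m) * (N' * (p^ dd * D₀)) * (N' - D)
        ≡⟨ regroup (c₂ f) (p^ m) (p^ dd) N' D₀ (N' - D) ⟩
      c₂ f * (N' * D₀) * (N' - D) * (p^ m * p^ m * p^ dd)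
        ≡⟨ cong (c₂ f * (N' * D₀) * (N' - D) *_) (sym p^M≡) ⟩
      c₂ f * (N' * D₀) * (N' - D) * p^ M                   ∎)
      where
      regroup : ∀ c a b n u v → c * (a * a) * (n * (b * u)) * v ≡ c * (n * u) * v * (a * a * b)
      regroup = solve-∀
      p^M≡ : p^ M ≡ p^ m * p^ m * p^ dd
      p^M≡ = trans (p^-+ (m ℕ.+ m) dd) (cong (_* p^ dd) (p^-+ m m))

  NearQuotient : ℕ → ℤ → ℤ → Set
  NearQuotient k N D = ∃[ a ] ∃[ b ] (eval f (+ suc b) ≢ + 0 ×
    ValGe p k (D * eval f (+ suc a) - N * eval f (+ suc b)) (D * eval f (+ suc b)))

  -- f is nearly linear near the approximate zero r = 1 + ρ, so with a = r + p^m N' and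
  -- b = r + p^m D the quotient f(a)/f(b) is close to N'/D, where N' ≡ N modulo p^(m+m+dd).
  close-quotient : ∀ k N d {dd e m ρ} → p^ dd ∥ + suc d → p^ e ∥ eval (deriv f) (+ suc ρ) →
                   p^ (m ℕ.+ m ℕ.+ dd) ∣ eval f (+ suc ρ) → k ℕ.+ e ℕ.+ dd < m →
                   NearQuotient k N (+ suc d)
  close-quotient k N d {dd} {e} {m} {ρ} D∥@(exactly D₀ D≡ _) f'r∥ fr∣ k+e+dd<m =
    a , b , ∥⇒≢0 fb∥ , ValGe-intro {k} (∣-trans (p^-mono-∣ quotient-exponent) numerator∣) (∥-* D∥ fb∥)
    where
    M = m ℕ.+ m ℕ.+ dd
    r = + suc ρ
    D = + suc d
    N' = (N ℤ.% p^ M) {{p^-nonZero M}}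
    a = ρ ℕ.+ p ℕ.^ m ℕ.* N'
    b = ρ ℕ.+ p ℕ.^ m ℕ.* suc d
    fb = eval f (+ suc b)

    shift : ∀ n → + suc (ρ ℕ.+ p ℕ.^ m ℕ.* n) ≡ r + p^ m * + n
    shift n = trans (ℤP.pos-+ (suc ρ) (p ℕ.^ m ℕ.* n)) (cong (_+_ r) (ℤP.pos-* (p ℕ.^ m) n))

    N≡N' : p^ M ∣ N - + N'
    N≡N' = divides q (trans (cong (_- + N') (a≡a%n+[a/n]*n N (p^ M) {{p^-nonZero M}})) (cancel (+ N') (q * p^ M)))
      where
      q = (N ℤ./ p^ M) {{p^-nonZero M}}
      cancel : ∀ n x → n + x - n ≡ x
      cancel = solve-∀

    numerator∣ : p^ M ∣ D * eval f (+ suc a) - N * fb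
    numerator∣ = subst (p^ M ∣_)
      (cong₂ (λ x y → D * eval f x - N * eval f y) (sym (shift N')) (sym (shift (suc d))))
      (cross-difference-∣ {m} {dd} r (+ N') N D D≡ fr∣ N≡N')

    e<m : e < m
    e<m = ℕP.≤-trans (s≤s (ℕP.≤-trans (ℕP.m≤n+m e k) (ℕP.m≤m+n (k ℕ.+ e) dd))) k+e+dd<m

    remainder-exponent : suc (e ℕ.+ (m ℕ.+ dd)) ≤ M
    remainder-exponent = subst (_≤ M) (ℕP.+-assoc (suc e) m dd) (ℕP.+-monoˡ-≤ dd (ℕP.+-monoˡ-≤ m e<m))

    quotient-exponent : k ℕ.+ (dd ℕ.+ (e ℕ.+ (m ℕ.+ dd))) ≤ M
    quotient-exponent =
      subst (_≤ M) (rearrange k e dd m) (ℕP.+-monoˡ-≤ dd (ℕP.+-monoˡ-≤ m (ℕP.<⇒≤ k+e+dd<m)))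
      where
      rearrange : ∀ k e dd m → k ℕ.+ e ℕ.+ dd ℕ.+ m ℕ.+ dd ≡ k ℕ.+ (dd ℕ.+ (e ℕ.+ (m ℕ.+ dd)))
      rearrange = ℕSolver.solve-∀

    fb∥ : p^ (e ℕ.+ (m ℕ.+ dd)) ∥ fb
    fb∥ = subst (p^ (e ℕ.+ (m ℕ.+ dd)) ∥_) (cong (eval f) (sym (shift (suc d))))
      (eval-shift-∥ (ℕP.≤-trans e<m (ℕP.m≤m+n m dd)) f'r∥ (∥-p^* m D∥)
                    (∣-trans (p^-mono-∣ remainder-exponent) fr∣))

  approximate-zeros⇒dense : disc f ≢ + 0 → HasApproximateZeros → DenseInQp p f
  approximate-zeros⇒dense Δ≢0 zeros (mkℚ N d _) k =
    -- m must be fixed before r, so it uses the bound v(f'(r)) ≤ δ instead of v(f'(r)) itself.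
    let (δ , Δ∥) = valuation Δ≢0
        (dd , D∥) = valuation {+ suc d} (λ ())
        m = suc (k ℕ.+ δ ℕ.+ dd)
        δ<m : δ < m
        δ<m = s≤s (ℕP.≤-trans (ℕP.m≤n+m δ k) (ℕP.m≤m+n (k ℕ.+ δ) dd))
        m≤M : m ≤ m ℕ.+ m ℕ.+ dd
        m≤M = ℕP.≤-trans (ℕP.m≤m+n m m) (ℕP.m≤m+n (m ℕ.+ m) dd)
        (ρ , fr∣) = zeros (m ℕ.+ m ℕ.+ dd)
        (e , e+e≡δ , f'r∥) = deriv-valuation Δ∥ (∣-trans (p^-mono-∣ (ℕP.≤-trans δ<m m≤M)) fr∣)
        e≤δ : e ≤ δ
        e≤δ = subst (e ≤_) e+e≡δ (ℕP.m≤m+n e e)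
    in close-quotient k N d D∥ f'r∥ fr∣ (s≤s (ℕP.+-monoˡ-≤ dd (ℕP.+-monoʳ-≤ k e≤δ)))

  disc≡0⇒c₂≢0 : Deg1or2 f → disc f ≡ + 0 → c₂ f ≢ + 0
  disc≡0⇒c₂≢0 (inj₁ c₂≢0) _ = c₂≢0
  disc≡0⇒c₂≢0 (inj₂ (c₂≡0 , c₁≢0)) Δ≡0 _ = *-≢0 c₁≢0 c₁≢0 (trans c₁²≡disc Δ≡0)
    where
    c₁²≡disc : c₁ f * c₁ f ≡ disc f
    c₁²≡disc = trans (vanish (c₁ f) (c₀ f))
      (cong (λ c → c₁ f * c₁ f - (c + c) * (c₀ f + c₀ f)) (sym c₂≡0))
      where
      vanish : ∀ b a → b * b ≡ b * b - (+ 0 + + 0) * (a + a)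
      vanish = solve-∀

  disc≡0⇒¬dense : Deg1or2 f → disc f ≡ + 0 → ¬ DenseInQp p f
  disc≡0⇒¬dense deg Δ≡0 dense with dense (mkℚ (+ p) 0 (Coprimality.sym (1-coprimeTo p))) 2
  ... | a , b , fb≢0 , u , w , p∤w , eq =
    unit*square≢p*unit*square {x = eval (deriv f) (+ suc a)} p∤w' (p∤-+ u p∤w') f'b≢0
      (disc≡0⇒deriv²-relation Δ≡0 w (+ p * (w + + p * u)) (+ suc a) (+ suc b) f-relation)
    where
    open ≡-Reasoning
    fa = eval f (+ suc a)
    fb = eval f (+ suc b)
    p∤w' : p∤ w
    p∤w' = p∤w ∘ ∣⇒∣ᵤ
    f-relation : w * fa ≡ + p * (w + + p * u) * fb
    f-relation = begin
      w * fa                                          ≡⟨ expand w fa fb (+ p) ⟩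
      w * (+ 1 * fa - + p * fb) + + p * (w * fb)      ≡⟨ cong (_+ + p * (w * fb)) eq ⟩
      p^ 2 * u * (+ 1 * fb) + + p * (w * fb)          ≡⟨ cong (λ a → a * u * (+ 1 * fb) + + p * (w * fb)) p²≡ ⟩
      + p * + p * u * (+ 1 * fb) + + p * (w * fb)     ≡⟨ collect w fb (+ p) u ⟩
      + p * (w + + p * u) * fb                        ∎
      where
      p²≡ : p^ 2 ≡ + p * + p
      p²≡ = trans (p^-+ 1 1) (cong₂ _*_ p^1≡p p^1≡p)
      expand : ∀ w fa fb p → w * fa ≡ w * (+ 1 * fa - p * fb) + p * (w * fb)
      expand = solve-∀
      collect : ∀ w fb p u → p * p * u * (+ 1 * fb) + p * (w * fb) ≡ p * (w + p * u) * fb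
      collect = solve-∀
    f'b≢0 : eval (deriv f) (+ suc b) ≢ + 0
    f'b≢0 f'b≡0 = *-≢0 (double-≢0 (disc≡0⇒c₂≢0 deg Δ≡0)) (double-≢0 fb≢0)
      (trans (sym (disc≡0⇒deriv²≡4c₂f Δ≡0 (+ suc b))) (cong (λ y → y * y) f'b≡0))

proposition1p4 : (p : ℕ) → Prime p → (f : Poly≤2) → Deg1or2 f →
    DenseInQp p f ⇔ HasSimpleZero p f
proposition1p4 p p-prime f deg = mk⇔ dense⇒simple-zero simple-zero⇒dense
  where
  open Quadratic p-prime f

  dense⇒simple-zero : DenseInQp p f → HasSimpleZero p f
  dense⇒simple-zero dense with disc f ℤ.≟ + 0
  ... | yes Δ≡0 = ⊥-elim (disc≡0⇒¬dense deg Δ≡0 dense)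
  ... | no Δ≢0 = approximate-zeros⇒simple-zero Δ≢0 (dense⇒approximate-zeros dense)

  simple-zero⇒dense : HasSimpleZero p f → DenseInQp p f
  simple-zero⇒dense simple@(α , root , _) =
    approximate-zeros⇒dense (simple-zero⇒disc≢0 simple) (root⇒approximate-zeros α root)
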